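{- If $n\geq 3$ and $m\geq 1$ are integers, then $\chi_\rho(FSSD_m(S'(K_n))) = n+2$.
   Context: All graphs are finite and simple. For a positive integer $i$, an $i$-packing is a set of vertices in which any two distinct vertices are at distance greater than $i$. The packing chromatic number $\chi_\rho(H)$ of a graph $H$ is the smallest integer $k$ such that $V(H)$ can be partitioned into sets $V_1,\dots,V_k$ with each $V_i$ an $i$-packing. The splitting graph $S'(G)$ of a graph $G$ with vertices $w_1,\dots,w_{n}$ is obtained from $G$ by adding $n$ new vertices $w_1',\dots,w_n'$ and joining each $w_i'$ to every neighbor of $w_i$ in $G$ (this is the neighborhood corona $G\star K_1$). $K_n$ is the complete graph on $n$ vertices. For a positive integer $m$, the finite super subdivision graph $FSSD_m(G)$ is obtained from a graph $G$ by replacing each edge $xy$ of $G$ by a complete bipartite graph $K_{2,m}$ whose part of size $2$ is $\{x,y\}$; that is, the edge $xy$ is deleted and $m$ new vertices are added, each adjacent exactly to $x$ and $y$. -}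

module Defs where

open import Data.Nat using (ℕ; zero; suc; _≤_; _<_; _+_; _<ᵇ_)
open import Data.Fin using (Fin; toℕ)
open import Data.Fin.Properties using () renaming (_≟_ to _≟F_)
open import Data.Bool using (Bool; true; false; not; _∧_; _∨_; T)
open import Data.Sum using (_⊎_; inj₁; inj₂)
open import Data.Product using (Σ; _×_; _,_)
open import Relation.Nullary using (¬_)
open import Relation.Nullary.Decidable using (⌊_⌋)
open import Relation.Binary.PropositionalEquality using (_≡_; _≢_)
open import Relation.Binary.Definitions using (DecidableEquality)

-- A finite simple graph given by its vertex type and a Boolean adjacency
-- relation (all concrete graphs below are finite, symmetric, irreflexive).
record Graph : Set₁ where
  field
    V   : Set
    adj : V → V → Bool
open Graph public

Adj : (G : Graph) → V G → V G → Set
Adj G u v = T (adj G u v)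

data Walk (G : Graph) : V G → V G → ℕ → Set where
  here : ∀ {u} → Walk G u u zero
  step : ∀ {u w v k} → Adj G u w → Walk G w v k → Walk G u v (suc k)

-- dist(u,v) > i  (no u-v walk, hence no path, of length ≤ i)
DistGt : (G : Graph) → V G → V G → ℕ → Set
DistGt G u v i = ∀ l → l ≤ i → ¬ Walk G u v l

-- A packing k-coloring: c u = j (j : Fin k) means u ∈ V_{j+1};
-- each V_i is an i-packing.
PackingColoring : (G : Graph) → (k : ℕ) → (V G → Fin k) → Set
PackingColoring G k c =
  ∀ u v → u ≢ v → c u ≡ c v → DistGt G u v (suc (toℕ (c u)))

PackingColorable : Graph → ℕ → Set
PackingColorable G k = Σ (V G → Fin k) (PackingColoring G k)

PackingChromaticNumberIs : Graph → ℕ → Set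
PackingChromaticNumberIs G k =
  PackingColorable G k × (∀ j → j < k → ¬ PackingColorable G j)

K : ℕ → Graph
K n = record { V = Fin n ; adj = λ i j → not ⌊ i ≟F j ⌋ }

-- splitting graph S'(G): inj₁ w = w, inj₂ w = w'
S' : Graph → Graph
S' G = record { V = V G ⊎ V G ; adj = a }
  where
  a : V G ⊎ V G → V G ⊎ V G → Bool
  a (inj₁ x) (inj₁ y) = adj G x y
  a (inj₁ x) (inj₂ y) = adj G x y
  a (inj₂ x) (inj₁ y) = adj G x y
  a (inj₂ x) (inj₂ y) = false

-- FSSD_m(G), given decidable equality on V G and a strict total order lt
-- on V G (used only to pick one orientation (x,y) with lt x y per edge xy).
-- New vertices: ((x , y) , proof that lt x y and xy ∈ E) , copy index j < m.
FSSD : ℕ → (G : Graph) → DecidableEquality (V G) → (V G → V G → Bool) → Graph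
FSSD m G _≟_ lt = record { V = W ; adj = a }
  where
  NewV : Set
  NewV = Σ (V G × V G) (λ { (x , y) → T (lt x y ∧ adj G x y) }) × Fin m
  W : Set
  W = V G ⊎ NewV
  a : W → W → Bool
  a (inj₁ u) (inj₁ v) = false
  a (inj₁ u) (inj₂ (((x , y) , _) , _)) = ⌊ u ≟ x ⌋ ∨ ⌊ u ≟ y ⌋
  a (inj₂ (((x , y) , _) , _)) (inj₁ u) = ⌊ u ≟ x ⌋ ∨ ⌊ u ≟ y ⌋
  a (inj₂ _) (inj₂ _) = false

≟S'K : (n : ℕ) → DecidableEquality (V (S' (K n)))
≟S'K n (inj₁ x) (inj₁ y) with x ≟F y
... | Relation.Nullary.yes Relation.Binary.PropositionalEquality.refl = Relation.Nullary.yes Relation.Binary.PropositionalEquality.refl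
... | Relation.Nullary.no p = Relation.Nullary.no λ { Relation.Binary.PropositionalEquality.refl → p Relation.Binary.PropositionalEquality.refl }
≟S'K n (inj₁ x) (inj₂ y) = Relation.Nullary.no λ ()
≟S'K n (inj₂ x) (inj₁ y) = Relation.Nullary.no λ ()
≟S'K n (inj₂ x) (inj₂ y) with x ≟F y
... | Relation.Nullary.yes Relation.Binary.PropositionalEquality.refl = Relation.Nullary.yes Relation.Binary.PropositionalEquality.refl
... | Relation.Nullary.no p = Relation.Nullary.no λ { Relation.Binary.PropositionalEquality.refl → p Relation.Binary.PropositionalEquality.refl }

ltS'K : (n : ℕ) → V (S' (K n)) → V (S' (K n)) → Bool
ltS'K n (inj₁ x) (inj₁ y) = toℕ x <ᵇ toℕ y
ltS'K n (inj₁ x) (inj₂ y) = true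
ltS'K n (inj₂ x) (inj₁ y) = false
ltS'K n (inj₂ x) (inj₂ y) = toℕ x <ᵇ toℕ y

FSSD-S'K : ℕ → ℕ → Graph
FSSD-S'K m n = FSSD m (S' (K n)) (≟S'K n) (ltS'K n)

module Submission where

-- Write w_a, w'_a for the vertices of S'(K_n); in FSSD_m every edge is
-- replaced by m "subdivision" vertices adjacent to both of its ends.
--
-- Upper bound: colour subdivision vertices 1, the copies w'_a colour 2 (two
-- copies are never adjacent in S'(K_n), so they lie at distance ≥ 4) and
-- give the w_a the distinct colours 3,…,n+2.
--
-- Lower bound: in a packing colouring two distinct w_a share a colour only
-- if it is 1 (they are at distance 2).
--  * If some w_a has colour 1, its 2(n-1) subdivision neighbours avoid
--    colour 1 and have pairwise distinct colours, so 2(n-1) + 1 colours are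
--    needed, which exceeds n + 1 when n ≥ 3.
--  * Otherwise the w_a carry n distinct colours ≥ 2; with only n + 1 colours
--    they use every colour ≥ 2. Let w_q have colour 2 and w_r colour 4.
--    Then w'_r must have colour 1, and a subdivision vertex s of the edge
--    w'_r w_q has a colour ≥ 3 shared with some w_a at distance 3 from s.

open import Defs
open import Data.Nat using (ℕ; zero; suc; _≤_; _<_; _+_; z≤n; s≤s)
open import Data.Nat.Properties using (+-comm; +-cancelˡ-≤; <-cmp; <⇒<ᵇ; ≤-refl; ≤-antisym; ≤-trans; <-irrefl; <-≤-trans; 1+n≰n)
open import Data.Fin using (Fin; toℕ; punchIn; punchOut; splitAt; join) renaming (zero to fz; suc to fs)
open import Data.Fin.Properties
  using (injective⇒≤; punchOut-injective; punchIn-punchOut; punchInᵢ≢i; punchIn-injective; join-splitAt; toℕ-injective; ¬Fin0; any?)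
  renaming (_≟_ to _≟F_)
open import Data.Bool using (Bool; _∨_; T)
open import Data.Bool.Properties using (T-∧; T-∨)
open import Data.Empty using (⊥; ⊥-elim)
open import Data.Sum using (_⊎_; inj₁; inj₂; [_,_]) renaming (map to map⊎)
open import Data.Sum.Properties using (inj₁-injective; inj₂-injective)
open import Data.Product using (_,_; proj₁; proj₂; ∃)
open import Function using (_∘_)
open import Function.Bundles using (_⇔_; mk⇔; Equivalence)
open import Function.Definitions using (Injective)
open import Relation.Nullary using (¬_; yes; no)
open import Relation.Nullary.Decidable using (⌊_⌋; toWitness; fromWitness; toWitnessFalse; fromWitnessFalse)
open import Relation.Binary.PropositionalEquality using (_≡_; _≢_; refl; sym; trans; cong; subst)
open import Relation.Binary.Definitions using (DecidableEquality; tri<; tri≈; tri>)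

_++ʷ_ : ∀ {G : Graph} {u v x k l} → Walk G u v k → Walk G v x l → Walk G u x (k + l)
here       ++ʷ q = q
step a p   ++ʷ q = step a (p ++ʷ q)

index≥2 : ∀ {k} (x : Fin (suc k)) → x ≢ fz → 2 ≤ suc (toℕ x)
index≥2 fz     x≢1 = ⊥-elim (x≢1 refl)
index≥2 (fs _) _   = s≤s (s≤s z≤n)

index≥3 : ∀ {k} (x : Fin (suc (suc k))) → x ≢ fz → x ≢ fs fz → 3 ≤ suc (toℕ x)
index≥3 fz          x≢1 _   = ⊥-elim (x≢1 refl)
index≥3 (fs fz)     _   x≢2 = ⊥-elim (x≢2 refl)
index≥3 (fs (fs _)) _   _   = s≤s (s≤s (s≤s z≤n))

module PackingColouring {G : Graph} {k : ℕ} {c : V G → Fin (suc k)}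
                        (packing : PackingColoring G (suc k) c) where

  too-close : ∀ {u v l} → Walk G u v l → u ≢ v → c u ≡ c v → l ≤ suc (toℕ (c u)) → ⊥
  too-close {u} {v} {l} walk u≢v same le = packing u v u≢v same l le walk

  adjacent-colours-differ : ∀ {u v} → Adj G u v → u ≢ v → c u ≢ c v
  adjacent-colours-differ a u≢v same = too-close (step a here) u≢v same (s≤s z≤n)

  shared-colour-at-distance-two : ∀ {u v} → Walk G u v 2 → u ≢ v → c u ≡ c v → c u ≡ fz
  shared-colour-at-distance-two {u} walk u≢v same with c u ≟F fz
  ... | yes is1 = is1
  ... | no not1 = ⊥-elim (too-close walk u≢v same (index≥2 (c u) not1))

injective-missing⇒< : ∀ {m n} {f : Fin m → Fin n} → Injective _≡_ _≡_ f →
                      (y : Fin n) → (∀ a → f a ≢ y) → m < n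
injective-missing⇒< {n = suc _} {f} f-inj y missed =
  s≤s (injective⇒≤ {f = λ a → punchOut (missed a ∘ sym)}
                   (λ eq → f-inj (punchOut-injective (missed _ ∘ sym) (missed _ ∘ sym) eq)))

injective⇒surjective : ∀ {m n} {f : Fin m → Fin n} → Injective _≡_ _≡_ f → n ≤ m →
                       ∀ y → ∃ λ a → f a ≡ y
injective⇒surjective {f = f} f-inj n≤m y with any? (λ a → f a ≟F y)
... | yes hit  = hit
... | no none = ⊥-elim (<-irrefl refl
                  (<-≤-trans (injective-missing⇒< f-inj y (λ a e → none (a , e))) n≤m))

module Subdivision (G : Graph) (_≟_ : DecidableEquality (V G)) (lt : V G → V G → Bool) (m : ℕ)
                   (G-sym : ∀ u v → Adj G u v → Adj G v u)
                   (orient : ∀ u v → Adj G u v → T (lt u v) ⊎ T (lt v u)) where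

  H : Graph
  H = FSSD m G _≟_ lt

  -- Every edge of H joins an old vertex to a subdivision vertex.
  H-sym : ∀ x y → Adj H x y → Adj H y x
  H-sym (inj₁ _) (inj₂ _) a = a
  H-sym (inj₂ _) (inj₁ _) a = a

  H-irrefl : ∀ {x y} → Adj H x y → x ≢ y
  H-irrefl {inj₁ _} {inj₂ _} _ ()
  H-irrefl {inj₂ _} {inj₁ _} _ ()

  incident : ∀ z x y → T (⌊ z ≟ x ⌋ ∨ ⌊ z ≟ y ⌋) ⇔ (z ≡ x ⊎ z ≡ y)
  incident z x y = mk⇔ (map⊎ toWitness toWitness ∘ Equivalence.to test)
                       (Equivalence.from test ∘ map⊎ fromWitness fromWitness)
    where
    test : T (⌊ z ≟ x ⌋ ∨ ⌊ z ≟ y ⌋) ⇔ (T ⌊ z ≟ x ⌋ ⊎ T ⌊ z ≟ y ⌋)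
    test = T-∨

  subdivider : ∀ u v → Adj G u v → Fin m → V H
  subdivider u v e k with orient u v e
  ... | inj₁ l = inj₂ (((u , v) , Equivalence.from T-∧ (l , e)) , k)
  ... | inj₂ l = inj₂ (((v , u) , Equivalence.from T-∧ (l , G-sym u v e)) , k)

  subdivider-neighbours : ∀ u v e k z → Adj H (inj₁ z) (subdivider u v e k) ⇔ (z ≡ u ⊎ z ≡ v)
  subdivider-neighbours u v e k z with orient u v e
  ... | inj₁ _ = incident z u v
  ... | inj₂ _ = mk⇔ (swap ∘ Equivalence.to (incident z v u)) (Equivalence.from (incident z v u) ∘ swap)
    where
    swap : ∀ {A B : Set} → A ⊎ B → B ⊎ A
    swap = [ inj₂ , inj₁ ]

  subdivider-adjˡ : ∀ u v e k → Adj H (inj₁ u) (subdivider u v e k)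
  subdivider-adjˡ u v e k = Equivalence.from (subdivider-neighbours u v e k u) (inj₁ refl)

  subdivider-adjʳ : ∀ u v e k → Adj H (inj₁ v) (subdivider u v e k)
  subdivider-adjʳ u v e k = Equivalence.from (subdivider-neighbours u v e k v) (inj₂ refl)

  detour : ∀ u v → Adj G u v → Fin m → Walk H (inj₁ u) (inj₁ v) 2
  detour u v e k = step {w = s} (subdivider-adjˡ u v e k) (step (H-sym (inj₁ v) s (subdivider-adjʳ u v e k)) here)
    where
    s : V H
    s = subdivider u v e k

  common-neighbour⇒adjacent : ∀ {u v} s → Adj H (inj₁ u) s → Adj H s (inj₁ v) → u ≢ v → Adj G u v
  common-neighbour⇒adjacent {u} {v} (inj₂ (((x , y) , p) , _)) au av u≢v
    with Equivalence.to (incident u x y) au | Equivalence.to (incident v x y) av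
  ... | inj₁ refl | inj₁ refl = ⊥-elim (u≢v refl)
  ... | inj₁ refl | inj₂ refl = proj₂ (Equivalence.to (T-∧ {lt x y}) p)
  ... | inj₂ refl | inj₁ refl = G-sym x y (proj₂ (Equivalence.to (T-∧ {lt x y}) p))
  ... | inj₂ refl | inj₂ refl = ⊥-elim (u≢v refl)

module Splitting (n m : ℕ) where

  S : Graph
  S = S' (K n)

  -- Distinct vertices of K_n are adjacent; all three edge types of S'(K_n)
  -- (w–w, w–w', w'–w) reduce to this adjacency.
  K-adj : ∀ {a b : Fin n} → a ≢ b → Adj (K n) a b
  K-adj = fromWitnessFalse

  S-sym : ∀ x y → Adj S x y → Adj S y x
  S-sym (inj₁ a) (inj₁ b) e = fromWitnessFalse (λ q → toWitnessFalse e (sym q))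
  S-sym (inj₁ a) (inj₂ b) e = fromWitnessFalse (λ q → toWitnessFalse e (sym q))
  S-sym (inj₂ a) (inj₁ b) e = fromWitnessFalse (λ q → toWitnessFalse e (sym q))

  S-orient : ∀ x y → Adj S x y → T (ltS'K n x y) ⊎ T (ltS'K n y x)
  S-orient (inj₁ a) (inj₁ b) e with <-cmp (toℕ a) (toℕ b)
  ... | tri< a<b _ _ = inj₁ (<⇒<ᵇ a<b)
  ... | tri≈ _ a≡b _ = ⊥-elim (toWitnessFalse e (toℕ-injective a≡b))
  ... | tri> _ _ b<a = inj₂ (<⇒<ᵇ b<a)
  S-orient (inj₁ _) (inj₂ _) _ = inj₁ _
  S-orient (inj₂ _) (inj₁ _) _ = inj₂ _

  open Subdivision S (≟S'K n) (ltS'K n) m S-sym S-orient public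

  w w' : Fin n → V H
  w a  = inj₁ (inj₁ a)
  w' a = inj₁ (inj₂ a)

  colour : V H → Fin (2 + n)
  colour (inj₁ (inj₁ a)) = fs (fs a)
  colour (inj₁ (inj₂ _)) = fs fz
  colour (inj₂ _)        = fz

  -- Copies are pairwise non-adjacent in S'(K_n), hence at distance > 2 in H;
  -- subdivision vertices are pairwise non-adjacent in H.
  colour-packing : PackingColoring H (2 + n) colour
  colour-packing (inj₁ (inj₁ a)) (inj₁ (inj₁ .a)) a≢b refl _ _ _ = a≢b refl
  colour-packing (inj₁ (inj₂ a)) (inj₁ (inj₂ b)) a≢b _ _ _ here = a≢b refl
  colour-packing (inj₁ (inj₂ a)) (inj₁ (inj₂ b)) _ _ _ _ (step () here)
  colour-packing (inj₁ (inj₂ a)) (inj₁ (inj₂ b)) a≢b _ _ _ (step {w = x} p (step q here)) =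
    common-neighbour⇒adjacent x p q (a≢b ∘ cong inj₁)
  colour-packing (inj₁ (inj₂ a)) (inj₁ (inj₂ b)) _ _ _ (s≤s (s≤s ())) (step _ (step _ (step _ _)))
  colour-packing (inj₂ s) (inj₂ t) s≢t _ _ _ here = s≢t refl
  colour-packing (inj₂ s) (inj₂ t) _ _ _ _ (step () here)
  colour-packing (inj₂ s) (inj₂ t) _ _ _ (s≤s ()) (step _ (step _ _))
  colour-packing (inj₁ (inj₁ _)) (inj₁ (inj₂ _)) _ () _ _ _
  colour-packing (inj₁ (inj₁ _)) (inj₂ _)        _ () _ _ _
  colour-packing (inj₁ (inj₂ _)) (inj₁ (inj₁ _)) _ () _ _ _
  colour-packing (inj₁ (inj₂ _)) (inj₂ _)        _ () _ _ _
  colour-packing (inj₂ _)        (inj₁ (inj₁ _)) _ () _ _ _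
  colour-packing (inj₂ _)        (inj₁ (inj₂ _)) _ () _ _ _

-- 2(n-1) colours do not fit among n + 1 colours once n ≥ 3 (p = n - 1).
star-too-big : ∀ {p k} → 2 ≤ p → p + p < suc k → k ≤ suc p → ⊥
star-too-big {p} 2≤p (s≤s p+p≤k) k≤1+p =
  1+n≰n (≤-trans 2≤p (+-cancelˡ-≤ p p 1 (subst (p + p ≤_) (+-comm 1 p) (≤-trans p+p≤k k≤1+p))))

module LowerBound (n' m' : ℕ) where

  n p : ℕ
  n = 3 + n'
  p = 2 + n'

  open Splitting n (suc m') public

  module Colouring {k : ℕ} {c : V H → Fin (suc k)} (packing : PackingColoring H (suc k) c) where
    open PackingColouring packing

    -- Distinct w_a lie at distance 2, so they can only share colour 1.
    original-shared-colour : ∀ {a b} → a ≢ b → c (w a) ≡ c (w b) → c (w a) ≡ fz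
    original-shared-colour {a} {b} a≢b =
      shared-colour-at-distance-two (detour (inj₁ a) (inj₁ b) (K-adj a≢b) fz) (a≢b ∘ inj₁-injective ∘ inj₁-injective)

    -- If w_a has colour 1, the 2(n-1) subdivision vertices s_t next to w_a
    -- (one per neighbour of w_a in S'(K_n)) need 2(n-1) colours other than 1.
    module Star (a : Fin n) (a-colour-1 : c (w a) ≡ fz) where

      neighbour : Fin p ⊎ Fin p → V S
      neighbour = map⊎ (punchIn a) (punchIn a)

      neighbour-adj : ∀ x → Adj S (inj₁ a) (neighbour x)
      neighbour-adj (inj₁ i) = K-adj (punchInᵢ≢i a i ∘ sym)
      neighbour-adj (inj₂ i) = K-adj (punchInᵢ≢i a i ∘ sym)

      neighbour≢a : ∀ x → neighbour x ≢ inj₁ a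
      neighbour≢a (inj₁ i) = punchInᵢ≢i a i ∘ inj₁-injective
      neighbour≢a (inj₂ i) ()

      neighbour-injective : Injective _≡_ _≡_ neighbour
      neighbour-injective {inj₁ i} {inj₁ j} eq = cong inj₁ (punchIn-injective a i j (inj₁-injective eq))
      neighbour-injective {inj₂ i} {inj₂ j} eq = cong inj₂ (punchIn-injective a i j (inj₂-injective eq))

      split-injective : Injective _≡_ _≡_ (splitAt p {p})
      split-injective {t} {t'} eq =
        trans (sym (join-splitAt p p t)) (trans (cong (join p p) eq) (join-splitAt p p t'))

      spoke : Fin (p + p) → V H
      spoke t = subdivider (inj₁ a) (neighbour (splitAt p t)) (neighbour-adj (splitAt p t)) fz

      spoke-adj : ∀ t → Adj H (w a) (spoke t)
      spoke-adj t = subdivider-adjˡ (inj₁ a) (neighbour (splitAt p t)) (neighbour-adj (splitAt p t)) fz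

      spoke-adj-end : ∀ t → Adj H (inj₁ (neighbour (splitAt p t))) (spoke t)
      spoke-adj-end t = subdivider-adjʳ (inj₁ a) (neighbour (splitAt p t)) (neighbour-adj (splitAt p t)) fz

      spoke-injective : Injective _≡_ _≡_ spoke
      spoke-injective {t} {t'} eq
        with Equivalence.to (subdivider-neighbours (inj₁ a) (neighbour (splitAt p t')) (neighbour-adj (splitAt p t')) fz _)
               (subst (Adj H (inj₁ (neighbour (splitAt p t)))) eq (spoke-adj-end t))
      ... | inj₁ at-a = ⊥-elim (neighbour≢a (splitAt p t) at-a)
      ... | inj₂ same = split-injective (neighbour-injective same)

      spoke-not-1 : ∀ t → c (spoke t) ≢ fz
      spoke-not-1 t is1 =
        adjacent-colours-differ (spoke-adj t) (H-irrefl (spoke-adj t)) (trans a-colour-1 (sym is1))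

      -- Two spokes are at distance 2 through w_a and avoid colour 1.
      spoke-colours-injective : Injective _≡_ _≡_ (c ∘ spoke)
      spoke-colours-injective {t} {t'} same with t ≟F t'
      ... | yes t≡t' = t≡t'
      ... | no t≢t' = ⊥-elim (spoke-not-1 t (shared-colour-at-distance-two through-a (t≢t' ∘ spoke-injective) same))
        where
        through-a : Walk H (spoke t) (spoke t') 2
        through-a = step (H-sym (w a) (spoke t) (spoke-adj t)) (step (spoke-adj t') here)

      many-colours : p + p < suc k
      many-colours = injective-missing⇒< spoke-colours-injective fz spoke-not-1

    module NoOriginalOne (none : ∀ a → c (w a) ≢ fz) where

      original-colours-injective : Injective _≡_ _≡_ (c ∘ w)
      original-colours-injective {a} {b} same with a ≟F b
      ... | yes a≡b = a≡b
      ... | no a≢b = ⊥-elim (none a (original-shared-colour a≢b same))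

      shifted : Fin n → Fin k
      shifted a = punchOut (none a ∘ sym)

      shifted-spec : ∀ a → fs (shifted a) ≡ c (w a)
      shifted-spec a = punchIn-punchOut (none a ∘ sym)

      shifted-injective : Injective _≡_ _≡_ shifted
      shifted-injective eq = original-colours-injective (punchOut-injective (none _ ∘ sym) (none _ ∘ sym) eq)

      at-least-n+1 : n ≤ k
      at-least-n+1 = injective⇒≤ shifted-injective

  module Saturated {c : V H → Fin (suc n)} (packing : PackingColoring H (suc n) c) (none : ∀ a → c (w a) ≢ fz) where
    open PackingColouring packing
    open Colouring packing
    open NoOriginalOne none

    palette : ∀ x → x ≢ fz → ∃ λ a → c (w a) ≡ x
    palette fz     x≢1 = ⊥-elim (x≢1 refl)
    palette (fs y) _   with injective⇒surjective shifted-injective ≤-refl y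
    ... | a , shifted≡y = a , trans (sym (shifted-spec a)) (cong fs shifted≡y)

    module Witnesses (q r : Fin n) (q-colour : c (w q) ≡ fs fz) (r-colour : c (w r) ≡ fs (fs (fs fz))) where

      r≢q : r ≢ q
      r≢q r≡q with trans (sym r-colour) (trans (cong (c ∘ w) r≡q) q-colour)
      ... | ()

      -- w_r and w'_r are at distance 4, via any other w_b.
      r-to-copy : Walk H (w r) (w' r) 4
      r-to-copy = detour (inj₁ r) (inj₁ b) (K-adj (b≢r ∘ sym)) fz ++ʷ detour (inj₁ b) (inj₂ r) (K-adj b≢r) fz
        where
        b : Fin n
        b = punchIn r fz
        b≢r : b ≢ r
        b≢r = punchInᵢ≢i r fz

      -- w'_r is within distance 4 of w_r (colour 4) and within distance 2 of
      -- every other w_a, so its colour is 1.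
      copy-colour-1 : c (w' r) ≡ fz
      copy-colour-1 with c (w' r) ≟F fz
      ... | yes is1 = is1
      ... | no not1 with palette (c (w' r)) not1
      ... | a , ca with a ≟F r
      ...   | yes refl = ⊥-elim (too-close r-to-copy (λ ()) ca
                            (subst (λ x → 4 ≤ suc (toℕ x)) (sym r-colour) (s≤s (s≤s (s≤s (s≤s z≤n))))))
      ...   | no a≢r = ⊥-elim (too-close (detour (inj₁ a) (inj₂ r) (K-adj a≢r) fz) (λ ()) ca (index≥2 _ (none a)))

      s : V H
      s = subdivider (inj₂ r) (inj₁ q) (K-adj r≢q) fz

      s-adj-copy : Adj H (w' r) s
      s-adj-copy = subdivider-adjˡ (inj₂ r) (inj₁ q) (K-adj r≢q) fz

      s-adj-q : Adj H (w q) s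
      s-adj-q = subdivider-adjʳ (inj₂ r) (inj₁ q) (K-adj r≢q) fz

      -- s avoids colour 1 (next to w'_r) and colour 2 (next to w_q); its colour
      -- is that of some w_a ≠ w_q at distance 3 from s.
      contradiction : ⊥
      contradiction with c s ≟F fz
      ... | yes is1 = adjacent-colours-differ s-adj-copy (H-irrefl s-adj-copy) (trans copy-colour-1 (sym is1))
      ... | no not1 with palette (c s) not1
      ... | a , ca with a ≟F q
      ...   | yes refl = adjacent-colours-differ s-adj-q (H-irrefl s-adj-q) ca
      ...   | no a≢q = too-close s-to-a (λ ()) (sym ca) (index≥3 (c s) not1 not2)
        where
        s-to-a : Walk H s (w a) 3
        s-to-a = step (H-sym (w q) s s-adj-q) (detour (inj₁ q) (inj₁ a) (K-adj (a≢q ∘ sym)) fz)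
        not2 : c s ≢ fs fz
        not2 is2 = a≢q (original-colours-injective (trans ca (trans is2 (sym q-colour))))

    contradiction : ⊥
    contradiction = Witnesses.contradiction (proj₁ colour-2) (proj₁ colour-4) (proj₂ colour-2) (proj₂ colour-4)
      where
      colour-2 : ∃ λ a → c (w a) ≡ fs fz
      colour-2 = palette (fs fz) λ ()
      colour-4 : ∃ λ a → c (w a) ≡ fs (fs (fs fz))
      colour-4 = palette (fs (fs (fs fz))) λ ()

  below : ∀ j → j < 2 + n → ¬ PackingColorable H j
  below zero    _                (c , _) = ¬Fin0 (c (w fz))
  below (suc k) (s≤s (s≤s k≤n)) (c , packing) with any? (λ a → c (w a) ≟F fz)
  ... | yes (a , a-colour-1) = star-too-big (s≤s (s≤s z≤n)) (Colouring.Star.many-colours packing a a-colour-1) k≤n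
  ... | no no-one with ≤-antisym k≤n (Colouring.NoOriginalOne.at-least-n+1 packing (λ a e → no-one (a , e)))
  ...   | refl = Saturated.contradiction packing (λ a e → no-one (a , e))

proposition9 : (n m : ℕ) → 3 ≤ n → 1 ≤ m →
    PackingChromaticNumberIs (FSSD-S'K m n) (n + 2)
proposition9 .(3 + n') .(suc m') (s≤s (s≤s (s≤s {n = n'} _))) (s≤s {n = m'} _) =
  subst (PackingChromaticNumberIs (FSSD-S'K (suc m') (3 + n'))) (+-comm 2 (3 + n'))
        ((colour , colour-packing) , below)
  where open LowerBound n' m'
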